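{- Let $\mathbf R=(R;\cdot,',0,1)$ be an effect groupoid and for $x,y\in R$ define $x\oplus y:=(x'\cdot y')'$, this being defined exactly when $x\cdot y=0$. Then $\mathbb E(\mathbf R):=(R;\oplus,',0,1)$ is a lattice effect algebra.
   Context: An effect groupoid is an algebra $(R;\cdot,',0,1)$ of type $(2,1,0,0)$ such that for all $x,y,z\in R$: (NG0) $1$ is a two-sided unit for $\cdot$; (NG1) $x=x''$; (NG2) $x\cdot 0=0\cdot x=0$; (NG3) $0'=1$; (NG4) $x\cdot(y\cdot x')=0=(y\cdot x')\cdot x$; (NG5) $x\cdot y=y\cdot[(y'\cdot x')'\cdot x']'$; (NG6) $x\cdot(y'\cdot x)'=(y'\cdot x)'\cdot x=(x'\cdot y)'\cdot y$; (NG7) $[(x\cdot y')'\cdot y']'\cdot z=[((x\cdot z)\cdot(y\cdot z)')'\cdot(y\cdot z)']'$; (NG8) if $x'\cdot y'=0$ and $(x\cdot y)'\cdot z'=0$ then $y'\cdot z'=0$, $x'\cdot(y\cdot z)'=0$ and $(x\cdot y)\cdot z=x\cdot(y\cdot z)$. An effect algebra is a partial algebra $(E;\oplus,',0,1)$ with $\oplus$ partial binary, such that: (E1) if $x\oplus y$ exists then $y\oplus x$ exists and equals it; (E2) if $x\oplus y$ and $(x\oplus y)\oplus z$ exist then $y\oplus z$ and $x\oplus(y\oplus z)$ exist and $(x\oplus y)\oplus z=x\oplus(y\oplus z)$; (E3) $x'$ is the unique element with $x\oplus x'$ defined and equal to $1$; (E4) if $x\oplus 1$ exists then $x=0$. Its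 induced order is $a\leq b$ iff $a\oplus c=b$ for some $c$. A lattice effect algebra is an effect algebra whose induced order is a lattice. -}

module Defs where

open import Level using (Level; _⊔_; suc)
open import Data.Product using (Σ; _×_; _,_)
open import Relation.Binary.PropositionalEquality using (_≡_)

record EffectGroupoid (ℓ : Level) : Set (suc ℓ) where
  infixl 7 _·_
  infix 8 _′
  field
    R   : Set ℓ
    _·_ : R → R → R
    _′  : R → R
    𝟘   : R
    𝟙   : R
    NG0l : ∀ x → 𝟙 · x ≡ x
    NG0r : ∀ x → x · 𝟙 ≡ x
    NG1  : ∀ x → x ≡ (x ′) ′
    NG2l : ∀ x → x · 𝟘 ≡ 𝟘
    NG2r : ∀ x → 𝟘 · x ≡ 𝟘
    NG3  : 𝟘 ′ ≡ 𝟙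
    NG4l : ∀ x y → x · (y · x ′) ≡ 𝟘
    NG4r : ∀ x y → (y · x ′) · x ≡ 𝟘
    NG5  : ∀ x y → x · y ≡ y · ((((y ′) · (x ′)) ′ · (x ′)) ′)
    NG6a : ∀ x y → x · (((y ′) · x) ′) ≡ ((y ′) · x) ′ · x
    NG6b : ∀ x y → ((y ′) · x) ′ · x ≡ ((x ′) · y) ′ · y
    NG7  : ∀ x y z →
           (((x · (y ′)) ′ · (y ′)) ′) · z
             ≡ (((x · z) · ((y · z) ′)) ′ · ((y · z) ′)) ′
    NG8  : ∀ x y z → (x ′) · (y ′) ≡ 𝟘 → ((x · y) ′) · (z ′) ≡ 𝟘 →
           ((y ′) · (z ′) ≡ 𝟘) × ((x ′) · ((y · z) ′) ≡ 𝟘)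
             × ((x · y) · z ≡ x · (y · z))

-- A partial binary operation on E: a domain predicate D and a value
-- for every pair in the domain (x ⊕ y is "defined" iff D x y holds).
-- Effect algebra axioms E1–E4.
record IsEffectAlgebra {ℓ d : Level} (E : Set ℓ) (D : E → E → Set d)
         (_⊕_ : (x y : E) → D x y → E) (_′ : E → E) (𝟘 𝟙 : E) : Set (ℓ ⊔ d) where
  field
    E1 : ∀ x y (p : D x y) → Σ (D y x) λ q → (y ⊕ x) q ≡ (x ⊕ y) p
    E2 : ∀ x y z (p : D x y) (q : D ((x ⊕ y) p) z) →
         Σ (D y z) λ r → Σ (D x ((y ⊕ z) r)) λ s →
           ((x ⊕ y) p ⊕ z) q ≡ (x ⊕ ((y ⊕ z) r)) s
    E3-def  : ∀ x → Σ (D x (x ′)) λ p → (x ⊕ (x ′)) p ≡ 𝟙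
    E3-uniq : ∀ x y (p : D x y) → (x ⊕ y) p ≡ 𝟙 → y ≡ x ′
    E4 : ∀ x → D x 𝟙 → x ≡ 𝟘

inducedLeq : {ℓ d : Level} {E : Set ℓ} (D : E → E → Set d)
             (_⊕_ : (x y : E) → D x y → E) → E → E → Set (ℓ ⊔ d)
inducedLeq {E = E} D _⊕_ a b = Σ E λ c → Σ (D a c) λ p → (a ⊕ c) p ≡ b

IsLatticeOrder : {ℓ r : Level} {E : Set ℓ} (_≤_ : E → E → Set r) → Set (ℓ ⊔ r)
IsLatticeOrder {E = E} _≤_ =
  (∀ a b → Σ E λ j → (a ≤ j) × (b ≤ j) × (∀ u → a ≤ u → b ≤ u → j ≤ u))
  × (∀ a b → Σ E λ m → (m ≤ a) × (m ≤ b) × (∀ l → l ≤ a → l ≤ b → l ≤ m))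

record IsLatticeEffectAlgebra {ℓ d : Level} (E : Set ℓ) (D : E → E → Set d)
         (_⊕_ : (x y : E) → D x y → E) (_′ : E → E) (𝟘 𝟙 : E) : Set (ℓ ⊔ d) where
  field
    isEffectAlgebra : IsEffectAlgebra E D _⊕_ _′ 𝟘 𝟙
    isLattice       : IsLatticeOrder (inducedLeq D _⊕_)

module _ {ℓ : Level} (G : EffectGroupoid ℓ) where
  open EffectGroupoid G
  𝔼-dom : R → R → Set ℓ
  𝔼-dom x y = x · y ≡ 𝟘
  𝔼-⊕ : (x y : R) → 𝔼-dom x y → R
  𝔼-⊕ x y _ = ((x ′) · (y ′)) ′

-- Write x ⊥ y for x · y = 0 (the domain of x ⊕ y = (x′ · y′)′).  The key
-- identity is NG6 instantiated at an orthogonal pair: if a ⊥ b then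
-- b = (b′ · a′)′ · a′, from which ⊥ is symmetric and x′, y′ commute whenever
-- x ⊥ y.  These give the effect algebra axioms E1–E4 (associativity is NG8).
--
-- For the lattice part we replace the induced order by the intrinsic
-- relation a ≼ b :⇔ a ⊥ b′ and show the two coincide; the witness of
-- a ≤ b is b · a′, because a ⊕ (b · a′) is the element
-- a ∨ b := ((a · b′)′ · b′)′, which equals b when a ≼ b.  This ∨ is a join
-- for ≼ (leastness is NG7), and ′ is an antitone involution, so meets are
-- (a′ ∨ b′)′.
module Submission where

open import Level using (Level; _⊔_)
open import Function using (flip)
open import Data.Product using (Σ; _×_; _,_)
open import Relation.Binary.PropositionalEquality
open import Defs

module OrderTheory {a r : Level} {E : Set a} where

  -- Every two elements have a least upper bound.  Joins (flip _≤_) says that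
  -- every two elements have a greatest lower bound, so
  -- IsLatticeOrder _≤_ is Joins _≤_ × Joins (flip _≤_).
  Joins : (E → E → Set r) → Set (a ⊔ r)
  Joins _≤_ = ∀ x y → Σ E λ j → (x ≤ j) × (y ≤ j) × (∀ u → x ≤ u → y ≤ u → j ≤ u)

  joins-transfer : {_≤₁_ _≤₂_ : E → E → Set r} →
                   (∀ {x y} → x ≤₁ y → x ≤₂ y) → (∀ {x y} → x ≤₂ y → x ≤₁ y) →
                   Joins _≤₁_ → Joins _≤₂_
  joins-transfer to from join x y with join x y
  ... | j , x≤j , y≤j , least =
    j , to x≤j , to y≤j , λ u x≤u y≤u → to (least u (from x≤u) (from y≤u))

  lattice-transfer : {_≤₁_ _≤₂_ : E → E → Set r} →
                     (∀ {x y} → x ≤₁ y → x ≤₂ y) → (∀ {x y} → x ≤₂ y → x ≤₁ y) →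
                     IsLatticeOrder _≤₁_ → IsLatticeOrder _≤₂_
  lattice-transfer to from (joins , meets) =
    joins-transfer to from joins , joins-transfer to from meets

  meets-from-joins : {_≤_ : E → E → Set r} (neg : E → E) →
                     (∀ x → neg (neg x) ≡ x) →
                     (∀ {x y} → x ≤ y → neg y ≤ neg x) →
                     Joins _≤_ → Joins (flip _≤_)
  meets-from-joins {_≤_} neg involutive antitone join x y with join (neg x) (neg y)
  ... | j , x′≤j , y′≤j , least = neg j , below x x′≤j , below y y′≤j , greatest
    where
    below : ∀ z → neg z ≤ j → neg j ≤ z
    below z z′≤j = subst (neg j ≤_) (involutive z) (antitone z′≤j)

    greatest : ∀ l → l ≤ x → l ≤ y → l ≤ neg j
    greatest l l≤x l≤y =
      subst (_≤ neg j) (involutive l) (antitone (least (neg l) (antitone l≤x) (antitone l≤y)))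

module EffectGroupoidTheory {ℓ : Level} (G : EffectGroupoid ℓ) where
  open EffectGroupoid G
  open ≡-Reasoning

  _⊥_ : R → R → Set ℓ
  _⊥_ = 𝔼-dom G

  _⊕_ : (x y : R) → x ⊥ y → R
  _⊕_ = 𝔼-⊕ G

  ′-involutive : ∀ x → x ′ ′ ≡ x
  ′-involutive x = sym (NG1 x)

  𝟙′≡𝟘 : 𝟙 ′ ≡ 𝟘
  𝟙′≡𝟘 = trans (cong _′ (sym NG3)) (′-involutive 𝟘)

  -- 0′ = 1 is a left unit; this is how x ⊥ y is consumed inside terms (x · y)′ · z.
  𝟘′-identityˡ : ∀ x → 𝟘 ′ · x ≡ x
  𝟘′-identityˡ x = trans (cong (_· x) NG3) (NG0l x)

  ⊥-complementʳ : ∀ x → x ⊥ (x ′)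
  ⊥-complementʳ x = trans (cong (x ·_) (sym (NG0l (x ′)))) (NG4l x 𝟙)

  ⊥-complementˡ : ∀ x → (x ′) ⊥ x
  ⊥-complementˡ x = trans (cong (_· x) (sym (NG0l (x ′)))) (NG4r x 𝟙)

  -- NG6 at an orthogonal pair: b is recovered from a and b by a term of the
  -- shape t · a′, which NG4 makes orthogonal to a from the left.
  ⊥-reconstruct : ∀ a b → a ⊥ b → b ≡ (b ′ · a ′) ′ · a ′
  ⊥-reconstruct a b a⊥b = begin
    b                       ≡⟨ sym (𝟘′-identityˡ b) ⟩
    𝟘 ′ · b                 ≡⟨ cong (λ t → t ′ · b) (sym a⊥b) ⟩
    (a · b) ′ · b           ≡⟨ cong (λ t → (t · b) ′ · b) (NG1 a) ⟩
    (a ′ ′ · b) ′ · b       ≡⟨ NG6b b (a ′) ⟩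
    (b ′ · a ′) ′ · a ′     ∎

  ⊥-sym : ∀ a b → a ⊥ b → b ⊥ a
  ⊥-sym a b a⊥b = trans (cong (_· a) (⊥-reconstruct a b a⊥b)) (NG4r a ((b ′ · a ′) ′))

  ⊥-complements-commute : ∀ x y → x ⊥ y → x ′ · y ′ ≡ y ′ · x ′
  ⊥-complements-commute x y x⊥y = trans (NG5 (x ′) (y ′)) (cong (y ′ ·_) (begin
    ((y ′ ′ · x ′ ′) ′ · x ′ ′) ′  ≡⟨ cong (λ t → (t ′ · x ′ ′) ′)
                                          (cong₂ _·_ (′-involutive y) (′-involutive x)) ⟩
    ((y · x) ′ · x ′ ′) ′          ≡⟨ cong (λ t → (t ′ · x ′ ′) ′) (⊥-sym x y x⊥y) ⟩
    (𝟘 ′ · x ′ ′) ′                ≡⟨ cong _′ (𝟘′-identityˡ (x ′ ′)) ⟩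
    x ′ ′ ′                        ≡⟨ ′-involutive (x ′) ⟩
    x ′                            ∎))

  ⊕-comm : ∀ x y (p : x ⊥ y) → Σ (y ⊥ x) λ q → (y ⊕ x) q ≡ (x ⊕ y) p
  ⊕-comm x y x⊥y = ⊥-sym x y x⊥y , cong _′ (sym (⊥-complements-commute x y x⊥y))

  ⊕-assoc : ∀ x y z (p : x ⊥ y) (q : ((x ⊕ y) p) ⊥ z) →
            Σ (y ⊥ z) λ r → Σ (x ⊥ ((y ⊕ z) r)) λ s →
              ((x ⊕ y) p ⊕ z) q ≡ (x ⊕ ((y ⊕ z) r)) s
  ⊕-assoc x y z x⊥y x⊕y⊥z
    with NG8 (x ′) (y ′) (z ′)
           (trans (cong₂ _·_ (′-involutive x) (′-involutive y)) x⊥y)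
           (trans (cong ((x ′ · y ′) ′ ·_) (′-involutive z)) x⊕y⊥z)
  ... | y⊥z , x⊥y⊕z , reassoc =
    trans (cong₂ _·_ (NG1 y) (NG1 z)) y⊥z ,
    trans (cong (_· _) (NG1 x)) x⊥y⊕z ,
    cong _′ (begin
      (x ′ · y ′) ′ ′ · z ′    ≡⟨ cong (_· z ′) (′-involutive _) ⟩
      (x ′ · y ′) · z ′        ≡⟨ reassoc ⟩
      x ′ · (y ′ · z ′)        ≡⟨ cong (x ′ ·_) (sym (′-involutive _)) ⟩
      x ′ · (y ′ · z ′) ′ ′    ∎)

  ⊕-complement : ∀ x → Σ (x ⊥ (x ′)) λ p → (x ⊕ (x ′)) p ≡ 𝟙
  ⊕-complement x = ⊥-complementʳ x , (begin
    (x ′ · x ′ ′) ′   ≡⟨ cong (λ t → (x ′ · t) ′) (′-involutive x) ⟩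
    (x ′ · x) ′       ≡⟨ cong _′ (⊥-complementˡ x) ⟩
    𝟘 ′               ≡⟨ NG3 ⟩
    𝟙                 ∎)

  -- E3, uniqueness: if x ⊕ y = 1 then x′ ⊥ y′, and reconstructing y gives x′.
  ⊕-complement-unique : ∀ x y (p : x ⊥ y) → (x ⊕ y) p ≡ 𝟙 → y ≡ x ′
  ⊕-complement-unique x y x⊥y x⊕y≡𝟙 = begin
    y                       ≡⟨ ⊥-reconstruct x y x⊥y ⟩
    (y ′ · x ′) ′ · x ′     ≡⟨ cong (λ t → t ′ · x ′) (sym (⊥-complements-commute x y x⊥y)) ⟩
    (x ′ · y ′) ′ · x ′     ≡⟨ cong (λ t → t ′ · x ′) x′⊥y′ ⟩
    𝟘 ′ · x ′               ≡⟨ 𝟘′-identityˡ (x ′) ⟩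
    x ′                     ∎
    where
    x′⊥y′ : (x ′) ⊥ (y ′)
    x′⊥y′ = trans (NG1 _) (trans (cong _′ x⊕y≡𝟙) 𝟙′≡𝟘)

  ⊥𝟙⇒𝟘 : ∀ x → x ⊥ 𝟙 → x ≡ 𝟘
  ⊥𝟙⇒𝟘 x x⊥𝟙 = trans (sym (NG0r x)) x⊥𝟙

  isEffectAlgebra : IsEffectAlgebra R _⊥_ _⊕_ _′ 𝟘 𝟙
  isEffectAlgebra = record
    { E1 = ⊕-comm
    ; E2 = ⊕-assoc
    ; E3-def = ⊕-complement
    ; E3-uniq = ⊕-complement-unique
    ; E4 = ⊥𝟙⇒𝟘
    }

  -- The intrinsic order; shown below to coincide with the induced order.
  _≼_ : R → R → Set ℓ
  a ≼ b = a ⊥ (b ′)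

  _≤_ : R → R → Set ℓ
  _≤_ = inducedLeq _⊥_ _⊕_

  _∨_ : R → R → R
  a ∨ b = ((a · b ′) ′ · b ′) ′

  ∨-comm : ∀ a b → a ∨ b ≡ b ∨ a
  ∨-comm a b = cong _′ (begin
    (a · b ′) ′ · b ′        ≡⟨ cong (λ t → (t · b ′) ′ · b ′) (NG1 a) ⟩
    (a ′ ′ · b ′) ′ · b ′    ≡⟨ NG6b (b ′) (a ′) ⟩
    (b ′ ′ · a ′) ′ · a ′    ≡⟨ cong (λ t → (t · a ′) ′ · a ′) (′-involutive b) ⟩
    (b · a ′) ′ · a ′        ∎)

  ∨-upperʳ : ∀ a b → b ≼ (a ∨ b)
  ∨-upperʳ a b = trans (cong (b ·_) (′-involutive _)) (NG4l b ((a · b ′) ′))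

  ∨-upperˡ : ∀ a b → a ≼ (a ∨ b)
  ∨-upperˡ a b = subst (a ≼_) (∨-comm b a) (∨-upperʳ b a)

  ∨-least : ∀ a b u → a ≼ u → b ≼ u → (a ∨ b) ≼ u
  ∨-least a b u a≼u b≼u = begin
    (a ∨ b) · u ′                                  ≡⟨ NG7 a b (u ′) ⟩
    (((a · u ′) · (b · u ′) ′) ′ · (b · u ′) ′) ′  ≡⟨ cong₂ (λ s t → ((s · t ′) ′ · t ′) ′) a≼u b≼u ⟩
    ((𝟘 · 𝟘 ′) ′ · 𝟘 ′) ′                          ≡⟨ cong (λ t → (t ′ · 𝟘 ′) ′) (NG2r _) ⟩
    (𝟘 ′ · 𝟘 ′) ′                                  ≡⟨ cong _′ (𝟘′-identityˡ (𝟘 ′)) ⟩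
    𝟘 ′ ′                                          ≡⟨ ′-involutive 𝟘 ⟩
    𝟘                                              ∎

  ∨-absorb : ∀ a b → a ≼ b → a ∨ b ≡ b
  ∨-absorb a b a≼b = begin
    ((a · b ′) ′ · b ′) ′   ≡⟨ cong (λ t → (t ′ · b ′) ′) a≼b ⟩
    (𝟘 ′ · b ′) ′           ≡⟨ cong _′ (𝟘′-identityˡ (b ′)) ⟩
    b ′ ′                   ≡⟨ ′-involutive b ⟩
    b                       ∎

  -- Adding to a the "difference" b · a′ yields the join (NG6a).
  ⊕-difference : ∀ a b → (a ⊕ (b · a ′)) (NG4l a b) ≡ b ∨ a
  ⊕-difference a b = cong _′ (begin
    a ′ · (b · a ′) ′         ≡⟨ cong (λ t → a ′ · (t · a ′) ′) (NG1 b) ⟩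
    a ′ · (b ′ ′ · a ′) ′     ≡⟨ NG6a (a ′) (b ′) ⟩
    (b ′ ′ · a ′) ′ · a ′     ≡⟨ cong (λ t → (t · a ′) ′ · a ′) (′-involutive b) ⟩
    (b · a ′) ′ · a ′         ∎)

  ≼⇒≤ : ∀ {a b} → a ≼ b → a ≤ b
  ≼⇒≤ {a} {b} a≼b =
    b · a ′ , NG4l a b , trans (⊕-difference a b) (trans (∨-comm b a) (∨-absorb a b a≼b))

  ≤⇒≼ : ∀ {a b} → a ≤ b → a ≼ b
  ≤⇒≼ {a} (c , a⊥c , refl) = begin
    a · (a ′ · c ′) ′ ′   ≡⟨ cong (a ·_) (′-involutive _) ⟩
    a · (a ′ · c ′)       ≡⟨ cong (a ·_) (⊥-complements-commute a c a⊥c) ⟩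
    a · (c ′ · a ′)       ≡⟨ NG4l a (c ′) ⟩
    𝟘                     ∎

  ≼-antitone : ∀ {a b} → a ≼ b → (b ′) ≼ (a ′)
  ≼-antitone {a} {b} a≼b = trans (cong (b ′ ·_) (′-involutive a)) (⊥-sym a (b ′) a≼b)

  ≼-lattice : IsLatticeOrder _≼_
  ≼-lattice = joins , OrderTheory.meets-from-joins _′ ′-involutive ≼-antitone joins
    where
    joins : OrderTheory.Joins _≼_
    joins a b = a ∨ b , ∨-upperˡ a b , ∨-upperʳ a b , ∨-least a b

  isLattice : IsLatticeOrder _≤_
  isLattice = OrderTheory.lattice-transfer ≼⇒≤ ≤⇒≼ ≼-lattice

mainTheorem2 : {ℓ : Level} (G : EffectGroupoid ℓ) →
    IsLatticeEffectAlgebra (EffectGroupoid.R G) (𝔼-dom G) (𝔼-⊕ G)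
      (EffectGroupoid._′ G) (EffectGroupoid.𝟘 G) (EffectGroupoid.𝟙 G)
mainTheorem2 G = record
  { isEffectAlgebra = EffectGroupoidTheory.isEffectAlgebra G
  ; isLattice       = EffectGroupoidTheory.isLattice G
  }
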